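{- Let $T$ be a Farey triple in $\mathbb{T}_3^{ -1}$ with $\mathbf g$-matrix $G$. For a $3\times3$ matrix $N=(n_{ij})$ define $N^{\phi}=(n_{\tau(i)\tau(j)})$ and $N^{\psi}=(n_{\tau^{ -1}(i)\tau^{ -1}(j)})$, where $\tau$ is the permutation of $\{1,2,3\}$ with $\tau(1)=3,\tau(2)=1,\tau(3)=2$. Then the $\mathbf g$-matrix of $\phi(T)$ is $G^{\phi}$ and the $\mathbf g$-matrix of $\psi(T)$ is $G^{\psi}$.
   Context: Farey triples: for $q\in\mathbb{Q}_\infty=\mathbb{Q}\cup\{\infty\}$ ($\infty$ largest), $d(q),r(q)$ are the integers with $q=d(q)/r(q)$, $\gcd=1$, $r(q)\ge0$ ($0=0/1$, $\infty=1/0$). A Farey triple is an unordered triple of elements of $\mathbb{Q}_\infty$ with $|d(q)r(q')-d(q')r(q)|=1$ for each pair; with components $q_f<q_s<q_t$ its mutations are $\mu_f:[q_s,\frac{d(q_s)+d(q_t)}{r(q_s)+r(q_t)},q_t]$, $\mu_s:[q_f,\frac{d(q_f)-d(q_t)}{r(q_f)-r(q_t)},q_t]$, $\mu_t:[q_f,\frac{d(q_f)+d(q_s)}{r(q_f)+r(q_s)},q_s]$. Each Farey triple has exactly one component of each type $\frac{\text{even}}{\text{odd}},\frac{\text{odd}}{\text{odd}},\frac{\text{odd}}{\text{even}}$, written in order $[q_0,q_{ -1},q_\infty]$; $\mu_0,\mu_{ -1},\mu_\infty$ mutate the component of the respective type. The exchange graph is a 3-regular tree $\mathbb{T}_3$,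 edges labeled $0,-1,\infty$ by the mutation type. $\mathbb{T}_3^i$ is the connected component of $\mathbb{T}_3$ minus $[\tfrac01,\tfrac{ -1}{1},\tfrac10]$ containing $\mu_i[\tfrac01,\tfrac{ -1}{1},\tfrac10]$. $\phi:\mathbb{T}_3^{ -1}\to\mathbb{T}_3^\infty$ is the graph isomorphism sending $[\tfrac01,\tfrac11,\tfrac10]$ to $[\tfrac01,\tfrac{ -1}{1},\tfrac{ -1}{2}]$ and edges labeled $-1,0,\infty$ to edges labeled $\infty,-1,0$; $\psi:\mathbb{T}_3^{ -1}\to\mathbb{T}_3^0$ is the graph isomorphism sending $[\tfrac01,\tfrac11,\tfrac10]$ to $[\tfrac{ -2}{1},\tfrac{ -1}{1},\tfrac10]$ and edges labeled $-1,0,\infty$ to edges labeled $0,\infty,-1$. Cluster algebra: indices $1,2,3$ labeled $0,-1,\infty$. $B^+=\begin{pmatrix}0&-2&2\\2&0&-2\\-2&2&0\end{pmatrix}$. $\mathcal{A}_M$ is the cluster algebra with principal coefficients with initial seed $(\tilde B_0,\{x_1,x_2,x_3\})$, coefficients $x_4,x_5,x_6$, $\tilde B_0$ having top block $B^+$ and bottom block $I_3$; seed mutation $\mu_k$: $b'_{ij}=-b_{ij}$ if $i=k$ or $j=k$, else $b_{ij}+\mathrm{sgn}(b_{ik})[b_{ik}b_{kj}]_+$, and $x_k'x_k=\prod_{i=1}^6x_i^{[b_{ik}]_+}+\prod_{i=1}^6x_i^{[-b_{ik}]_+}$. The triple $\mu_{a_n}\cdots\mu_{a_1}[\tfrac01,\tfrac{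 -1}{1},\tfrac10]$ is assigned the seed $\mu_{a_n}\cdots\mu_{a_1}(\tilde B_0,\{x_1,x_2,x_3\})$ (with $\mu_0,\mu_{ -1},\mu_\infty$ acting as $\mu_1,\mu_2,\mu_3$). With the $\mathbb{Z}^3$-grading $\deg x_j=\mathbf e_j$ ($j\le3$), $\deg x_{3+j}=-(j\text{ -th column of }B^+)$, each cluster variable is homogeneous; its degree is its $\mathbf g$-vector, and the $\mathbf g$-matrix of a triple has as columns the $\mathbf g$-vectors of the cluster variables of its seed in order $0,-1,\infty$. -}

module Defs where

open import Data.Nat as ℕ using (ℕ; zero; suc)
open import Data.Integer as ℤ using (ℤ; +_; -[1+_]; 0ℤ; 1ℤ)
open import Data.Fin as Fin using (Fin; zero; suc; _↑ˡ_)
open import Data.Vec as Vec using (Vec; []; _∷_)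
open import Data.Vec.Properties using (≡-dec)
open import Data.List as List using (List; []; _∷_)
open import Data.Product using (Σ; ∃; _×_; _,_)
open import Data.Bool using (Bool; true; false; if_then_else_; _∨_)
open import Relation.Nullary using (¬_; yes; no; does)
open import Relation.Binary.PropositionalEquality using (_≡_; _≢_)
open import Data.Empty using (⊥)
open import Data.Unit using (⊤)

-- Polynomials in x₁,…,x₆ with integer coefficients, as finite lists of
-- terms (coefficient , exponent vector).  Equality is semantic, via the
-- coefficient function 'coeff'.

Mono : Set
Mono = Vec ℕ 6

Poly : Set
Poly = List (ℤ × Mono)

coeff : Poly → Mono → ℤ
coeff [] m = 0ℤ
coeff ((c , e) ∷ p) m = if does (≡-dec ℕ._≟_ e m) then c ℤ.+ coeff p m else coeff p m

pOne : Poly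
pOne = (1ℤ , Vec.replicate 6 0) ∷ []

pVar : Fin 6 → Poly
pVar i = (1ℤ , Vec.tabulate (λ j → if does (i Fin.≟ j) then 1 else 0)) ∷ []

pAdd : Poly → Poly → Poly
pAdd = List._++_

pMul : Poly → Poly → Poly
pMul p q = List.concatMap (λ { (a , m) → List.map (λ { (b , n) → (a ℤ.* b , Vec.zipWith ℕ._+_ m n) }) q }) p

-- Rational functions in x₁,…,x₆ as (numerator , denominator).

Frac : Set
Frac = Poly × Poly

fOne : Frac
fOne = (pOne , pOne)

fMul : Frac → Frac → Frac
fMul (a , b) (c , d) = (pMul a c , pMul b d)

fAdd : Frac → Frac → Frac
fAdd (a , b) (c , d) = (pAdd (pMul a d) (pMul c b) , pMul b d)

fDiv : Frac → Frac → Frac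
fDiv (a , b) (c , d) = (pMul a d , pMul b c)

fPow : Frac → ℕ → Frac
fPow x zero = fOne
fPow x (suc n) = fMul x (fPow x n)

fProd : (Fin 6 → Frac) → Frac
fProd f = List.foldr (λ i acc → fMul (f i) acc) fOne (List.allFin 6)

-- Seeds: extended exchange matrix B̃ (6 × 3, rows i, columns j) and a
-- cluster of three elements; x₄,x₅,x₆ are the (frozen) coefficients.

[_]₊ : ℤ → ℕ
[ + n ]₊ = n
[ -[1+ n ] ]₊ = 0

sgn· : ℤ → ℤ → ℤ
sgn· (+ zero) c = 0ℤ
sgn· (+ suc n) c = c
sgn· -[1+ n ] c = ℤ.- c

record Seed : Set where
  constructor seed
  field
    mat : Fin 6 → Fin 3 → ℤ
    clu : Fin 3 → Frac
open Seed public

row : Fin 3 → Fin 6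
row k = k ↑ˡ 3

ext : Seed → Fin 6 → Frac
ext s zero = clu s zero
ext s (suc zero) = clu s (suc zero)
ext s (suc (suc zero)) = clu s (suc (suc zero))
ext s i = (pVar i , pOne)

mutMat : Fin 3 → (Fin 6 → Fin 3 → ℤ) → Fin 6 → Fin 3 → ℤ
mutMat k b i j =
  if does (i Fin.≟ row k) ∨ does (j Fin.≟ k)
  then ℤ.- b i j
  else b i j ℤ.+ sgn· (b i k) (+ [ b i k ℤ.* b (row k) j ]₊)

mutate : Fin 3 → Seed → Seed
mutate k s = seed (mutMat k (mat s)) newClu
  where
  P Q : Frac
  P = fProd (λ i → fPow (ext s i) [ mat s i k ]₊)
  Q = fProd (λ i → fPow (ext s i) [ ℤ.- mat s i k ]₊)
  newClu : Fin 3 → Frac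
  newClu j = if does (j Fin.≟ k) then fDiv (fAdd P Q) (clu s k) else clu s j

-- B⁺ (indices 1,2,3 ↔ labels 0,-1,∞)
Bplus : Fin 3 → Fin 3 → ℤ
Bplus i j = Vec.lookup (Vec.lookup rows i) j
  where
  rows : Vec (Vec ℤ 3) 3
  rows = (0ℤ ∷ ℤ.- + 2 ∷ + 2 ∷ [])
       ∷ (+ 2 ∷ 0ℤ ∷ ℤ.- + 2 ∷ [])
       ∷ (ℤ.- + 2 ∷ + 2 ∷ 0ℤ ∷ [])
       ∷ []

B0 : Fin 6 → Fin 3 → ℤ
B0 zero j = Bplus zero j
B0 (suc zero) j = Bplus (suc zero) j
B0 (suc (suc zero)) j = Bplus (suc (suc zero)) j
B0 (suc (suc (suc i))) j = if does (i Fin.≟ j) then 1ℤ else 0ℤ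

initialSeed : Seed
initialSeed = seed B0 (λ j → (pVar (row j) , pOne))

-- A vertex of the 3-regular tree 𝕋₃ is
-- identified with the reduced word a₁ a₂ … aₙ (no two consecutive equal
-- labels) such that it equals μ_{aₙ}⋯μ_{a₁}[0/1,-1/1,1/0]; the list is
-- written a₁ first.

data Lbl : Set where
  L0 L-1 L∞ : Lbl

idx : Lbl → Fin 3
idx L0 = zero
idx L-1 = suc zero
idx L∞ = suc (suc zero)

Reduced : List Lbl → Set
Reduced [] = ⊤
Reduced (a ∷ []) = ⊤
Reduced (a ∷ b ∷ w) = (a ≢ b) × Reduced (b ∷ w)

-- vertex lies in 𝕋₃^{-1}: the path from the root starts with μ_{-1}
InT3m1 : List Lbl → Set
InT3m1 w = Σ (List Lbl) (λ v → w ≡ L-1 ∷ v) × Reduced w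

seedOf : List Lbl → Seed
seedOf w = List.foldl (λ s a → mutate (idx a) s) initialSeed w

-- φ and ψ on vertices: φ(μ_{-1} root) = μ_∞ root, ψ(μ_{-1} root) = μ_0 root,
-- and edge labels relabelled -1,0,∞ ↦ ∞,-1,0 (φ), resp. ↦ 0,∞,-1 (ψ).
σφ : Lbl → Lbl
σφ L-1 = L∞
σφ L0 = L-1
σφ L∞ = L0

σψ : Lbl → Lbl
σψ L-1 = L0
σψ L0 = L∞
σψ L∞ = L-1

φ : List Lbl → List Lbl
φ = List.map σφ

ψ : List Lbl → List Lbl
ψ = List.map σψ

Deg : Set
Deg = Vec ℤ 3

e : Fin 3 → Deg
e i = Vec.tabulate (λ j → if does (i Fin.≟ j) then 1ℤ else 0ℤ)

degVar : Fin 6 → Deg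
degVar zero = e zero
degVar (suc zero) = e (suc zero)
degVar (suc (suc zero)) = e (suc (suc zero))
degVar (suc (suc (suc j))) = Vec.tabulate (λ i → ℤ.- Bplus i j)

dAdd : Deg → Deg → Deg
dAdd = Vec.zipWith ℤ._+_

dSub : Deg → Deg → Deg
dSub = Vec.zipWith ℤ._-_

monoDeg : Mono → Deg
monoDeg m = List.foldr (λ i acc → dAdd (Vec.map (λ d → + Vec.lookup m i ℤ.* d) (degVar i)) acc)
                       (Vec.replicate 3 0ℤ) (List.allFin 6)

Homogeneous : Poly → Deg → Set
Homogeneous p d = ∀ m → coeff p m ≢ 0ℤ → monoDeg m ≡ d

NonzeroPoly : Poly → Set
NonzeroPoly g = ∃ λ m → coeff g m ≢ 0ℤ

HasDeg : Frac → Deg → Set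
HasDeg (n , d) v =
  Σ Poly λ f → Σ Poly λ g → Σ Deg λ a → Σ Deg λ b →
    Homogeneous f a × Homogeneous g b × NonzeroPoly g ×
    (∀ m → coeff (pMul n g) m ≡ coeff (pMul f d) m) × (v ≡ dSub a b)

Mat3 : Set
Mat3 = Fin 3 → Fin 3 → ℤ

-- G is the g-matrix of the vertex w: column j is the g-vector of the
-- j-th cluster variable (order 0, -1, ∞)
IsGMatrix : List Lbl → Mat3 → Set
IsGMatrix w G = ∀ j → HasDeg (clu (seedOf w) j) (Vec.tabulate (λ i → G i j))

τ : Fin 3 → Fin 3
τ zero = suc (suc zero)
τ (suc zero) = zero
τ (suc (suc zero)) = suc zero

τ⁻¹ : Fin 3 → Fin 3
τ⁻¹ zero = suc zero
τ⁻¹ (suc zero) = suc (suc zero)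
τ⁻¹ (suc (suc zero)) = zero

_^φ : Mat3 → Mat3
(N ^φ) i j = N (τ i) (τ j)

_^ψ : Mat3 → Mat3
(N ^ψ) i j = N (τ⁻¹ i) (τ⁻¹ j)

-- The cyclic relabelling ρ : 0 ↦ -1 ↦ ∞ ↦ 0 of the three directions, with
-- the matching renaming π = lift ρ of x₁,…,x₆ (cluster variables and
-- coefficients alike), fixes the initial extended exchange matrix B̃₀ and
-- moves the degrees of x₁,…,x₆ by the permutation τ = ρ⁻¹ of ℤ³.  Hence
-- mutating along the ρ-relabelled word yields, step by step, the π-renamed
-- seed.  Renaming is a homomorphism of the polynomial operations and
-- permutes degrees by τ, so every g-vector is permuted by τ and the
-- g-matrix of φ(T) is G^φ.  Since ψ = φ ∘ φ and τ ∘ τ = τ⁻¹, the ψ half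
-- follows by applying the φ half twice.
module Submission where

open import Defs
open import Level using (0ℓ)
open import Function.Bundles using (_⇔_; mk⇔)
open import Data.Bool using (Bool; true; false; if_then_else_)
open import Data.Product using (_,_; proj₁; proj₂; _×_)
open import Data.Nat as ℕ using (ℕ)
import Data.Nat.Properties as ℕP
open import Data.Integer using (ℤ; 0ℤ; 1ℤ; _+_; _*_; -_; _-_)
import Data.Integer as ℤ using (+_; _≟_)
import Data.Integer.Properties as ℤP
open import Data.Integer.Tactic.RingSolver using (solve-∀)
open import Data.Fin as Fin using (Fin; zero; suc)
import Data.Fin.Properties as FinP
open import Data.Vec as Vec using (Vec)
import Data.Vec.Properties as VecP
open import Data.List as List using (List; []; _∷_)
import Data.List.Properties as ListP
open import Data.List.Relation.Binary.Permutation.Propositional using (_↭_; ↭⇒↭ₛ′)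
open import Data.List.Relation.Binary.Permutation.Propositional.Properties using () renaming (map⁺ to ↭-map⁺; ++⁺ to ↭-++⁺; shift to ↭-shift)
open import Data.List.Relation.Binary.Permutation.Setoid.Properties using (foldr-commMonoid)
open import Relation.Nullary using (does)
open import Relation.Nullary.Decidable using (does-⇔; from-yes)
open import Relation.Binary using (IsEquivalence)
open import Relation.Binary.PropositionalEquality using (_≡_; _≢_; refl; sym; trans; cong; cong₂; subst; subst₂; module ≡-Reasoning) renaming (isEquivalence to ≡-isEquivalence)
import Relation.Binary.Reasoning.Setoid as SetoidReasoning
open import Algebra.Structures using (IsCommutativeMonoid)
open import Algebra.Bundles using (CommutativeMonoid)

_⊕_ : Mono → Mono → Mono
u ⊕ v = Vec.zipWith ℕ._+_ u v

lin : (Mono → ℤ) → Poly → ℤ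
lin F [] = 0ℤ
lin F ((c , u) ∷ p) = c * F u + lin F p

-- Two term lists represent the same polynomial when no weight tells them
-- apart.  (Taking indicator weights shows this implies equal coefficients.)
record _≋_ (p q : Poly) : Set where
  constructor mk≋
  field lin-≡ : ∀ F → lin F p ≡ lin F q

≋-refl : ∀ {p} → p ≋ p
≋-refl = mk≋ λ F → refl

≋-sym : ∀ {p q} → p ≋ q → q ≋ p
≋-sym (mk≋ e) = mk≋ λ F → sym (e F)

≋-trans : ∀ {p q r} → p ≋ q → q ≋ r → p ≋ r
≋-trans (mk≋ e) (mk≋ f) = mk≋ λ F → trans (e F) (f F)

≋-reflexive : ∀ {p q} → p ≡ q → p ≋ q
≋-reflexive refl = ≋-refl

lin-cong : ∀ {F G : Mono → ℤ} → (∀ u → F u ≡ G u) → ∀ p → lin F p ≡ lin G p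
lin-cong F≗G [] = refl
lin-cong F≗G ((c , u) ∷ p) = cong₂ (λ x y → c * x + y) (F≗G u) (lin-cong F≗G p)

lin-++ : ∀ F p q → lin F (p List.++ q) ≡ lin F p + lin F q
lin-++ F [] q = sym (ℤP.+-identityˡ _)
lin-++ F ((c , u) ∷ p) q =
  trans (cong ((c * F u) +_) (lin-++ F p q)) (sym (ℤP.+-assoc (c * F u) (lin F p) (lin F q)))

lin-zero : ∀ p → lin (λ _ → 0ℤ) p ≡ 0ℤ
lin-zero [] = refl
lin-zero ((c , u) ∷ p) = cong₂ _+_ (ℤP.*-zeroʳ c) (lin-zero p)

lin-+ : ∀ F G p → lin (λ u → F u + G u) p ≡ lin F p + lin G p
lin-+ F G [] = refl
lin-+ F G ((c , u) ∷ p) =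
  trans (cong ((c * (F u + G u)) +_) (lin-+ F G p)) (distrib c (F u) (G u) (lin F p) (lin G p))
  where
  distrib : ∀ c x y X Y → c * (x + y) + (X + Y) ≡ (c * x + X) + (c * y + Y)
  distrib = solve-∀

lin-scale : ∀ a F p → lin (λ u → a * F u) p ≡ a * lin F p
lin-scale a F [] = sym (ℤP.*-zeroʳ a)
lin-scale a F ((c , u) ∷ p) =
  trans (cong ((c * (a * F u)) +_) (lin-scale a F p)) (pull a c (F u) (lin F p))
  where
  pull : ∀ a c x X → c * (a * x) + a * X ≡ a * (c * x + X)
  pull = solve-∀

lin-swap : ∀ (G : Mono → Mono → ℤ) p q →
  lin (λ u → lin (G u) q) p ≡ lin (λ v → lin (λ u → G u v) p) q
lin-swap G [] q = sym (lin-zero q)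
lin-swap G ((c , u) ∷ p) q =
  trans (cong₂ _+_ (sym (lin-scale c (G u) q)) (lin-swap G p q))
        (sym (lin-+ (λ v → c * G u v) (λ v → lin (λ u → G u v) p) q))

lin-term-times : ∀ F c u (f : ℤ × Mono → ℤ × Mono) → (∀ b v → f (b , v) ≡ (c * b , u ⊕ v)) →
  ∀ q → lin F (List.map f q) ≡ c * lin (λ v → F (u ⊕ v)) q
lin-term-times F c u f f-def [] = sym (ℤP.*-zeroʳ c)
lin-term-times F c u f f-def ((b , v) ∷ q) rewrite f-def b v =
  trans (cong (((c * b) * F (u ⊕ v)) +_) (lin-term-times F c u f f-def q))
        (pull c b (F (u ⊕ v)) (lin (λ v → F (u ⊕ v)) q))
  where
  pull : ∀ c b x X → (c * b) * x + c * X ≡ c * (b * x + X)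
  pull = solve-∀

lin-pMul : ∀ F p q → lin F (pMul p q) ≡ lin (λ u → lin (λ v → F (u ⊕ v)) q) p
lin-pMul F [] q = refl
lin-pMul F ((c , u) ∷ p) q =
  trans (lin-++ F (List.map _ q) (pMul p q))
        (cong₂ _+_ (lin-term-times F c u _ (λ b v → refl) q) (lin-pMul F p q))

pMul-cong : ∀ {p p′ q q′} → p ≋ p′ → q ≋ q′ → pMul p q ≋ pMul p′ q′
pMul-cong {p} {p′} {q} {q′} (mk≋ p≋p′) (mk≋ q≋q′) = mk≋ λ F → begin
  lin F (pMul p q)                              ≡⟨ lin-pMul F p q ⟩
  lin (λ u → lin (λ v → F (u ⊕ v)) q) p         ≡⟨ p≋p′ _ ⟩
  lin (λ u → lin (λ v → F (u ⊕ v)) q) p′        ≡⟨ lin-cong (λ u → q≋q′ (λ v → F (u ⊕ v))) p′ ⟩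
  lin (λ u → lin (λ v → F (u ⊕ v)) q′) p′       ≡⟨ lin-pMul F p′ q′ ⟨
  lin F (pMul p′ q′)                            ∎
  where open ≡-Reasoning

pAdd-cong : ∀ {p p′ q q′} → p ≋ p′ → q ≋ q′ → pAdd p q ≋ pAdd p′ q′
pAdd-cong {p} {p′} {q} {q′} (mk≋ p≋p′) (mk≋ q≋q′) = mk≋ λ F →
  trans (lin-++ F p q) (trans (cong₂ _+_ (p≋p′ F) (q≋q′ F)) (sym (lin-++ F p′ q′)))

pMul-comm : ∀ p q → pMul p q ≋ pMul q p
pMul-comm p q = mk≋ λ F → begin
  lin F (pMul p q)                              ≡⟨ lin-pMul F p q ⟩
  lin (λ u → lin (λ v → F (u ⊕ v)) q) p         ≡⟨ lin-swap (λ u v → F (u ⊕ v)) p q ⟩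
  lin (λ v → lin (λ u → F (u ⊕ v)) p) q         ≡⟨ lin-cong (λ v → lin-cong (λ u → cong F (⊕-comm u v)) p) q ⟩
  lin (λ v → lin (λ u → F (v ⊕ u)) p) q         ≡⟨ lin-pMul F q p ⟨
  lin F (pMul q p)                              ∎
  where
  open ≡-Reasoning
  ⊕-comm : ∀ u v → u ⊕ v ≡ v ⊕ u
  ⊕-comm = VecP.zipWith-comm ℕP.+-comm

pMul-assoc : ∀ p q r → pMul (pMul p q) r ≋ pMul p (pMul q r)
pMul-assoc p q r = mk≋ λ F → begin
  lin F (pMul (pMul p q) r)                                     ≡⟨ lin-pMul F (pMul p q) r ⟩
  lin (λ w → lin (λ x → F (w ⊕ x)) r) (pMul p q)                ≡⟨ lin-pMul _ p q ⟩
  lin (λ u → lin (λ v → lin (λ x → F ((u ⊕ v) ⊕ x)) r) q) p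
    ≡⟨ lin-cong (λ u → lin-cong (λ v → lin-cong (λ x → cong F (⊕-assoc u v x)) r) q) p ⟩
  lin (λ u → lin (λ v → lin (λ x → F (u ⊕ (v ⊕ x))) r) q) p     ≡⟨ lin-cong (λ u → lin-pMul (λ w → F (u ⊕ w)) q r) p ⟨
  lin (λ u → lin (λ w → F (u ⊕ w)) (pMul q r)) p                ≡⟨ lin-pMul F p (pMul q r) ⟨
  lin F (pMul p (pMul q r))                                     ∎
  where
  open ≡-Reasoning
  ⊕-assoc : ∀ u v w → (u ⊕ v) ⊕ w ≡ u ⊕ (v ⊕ w)
  ⊕-assoc = VecP.zipWith-assoc ℕP.+-assoc

pMul-identityˡ : ∀ p → pMul pOne p ≋ p
pMul-identityˡ p = mk≋ λ F → begin
  lin F (pMul pOne p)                           ≡⟨ lin-pMul F pOne p ⟩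
  1ℤ * lin (λ v → F (Vec.replicate 6 0 ⊕ v)) p + 0ℤ
                                                ≡⟨ trans (ℤP.+-identityʳ _) (ℤP.*-identityˡ _) ⟩
  lin (λ v → F (Vec.replicate 6 0 ⊕ v)) p       ≡⟨ lin-cong (λ v → cong F (VecP.zipWith-identityˡ ℕP.+-identityˡ v)) p ⟩
  lin F p                                       ∎
  where open ≡-Reasoning

-- Coefficients are the values under indicator weights, so ≋ fixes them.
indicator : Mono → Mono → ℤ
indicator m u = if does (VecP.≡-dec ℕ._≟_ u m) then 1ℤ else 0ℤ

coeff-as-lin : ∀ p m → coeff p m ≡ lin (indicator m) p
coeff-as-lin [] m = refl
coeff-as-lin ((c , u) ∷ p) m with does (VecP.≡-dec ℕ._≟_ u m)
... | true = cong₂ _+_ (sym (ℤP.*-identityʳ c)) (coeff-as-lin p m)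
... | false = trans (coeff-as-lin p m) (sym (trans (cong (_+ lin (indicator m) p) (ℤP.*-zeroʳ c)) (ℤP.+-identityˡ _)))

≋⇒coeff : ∀ {p q} → p ≋ q → ∀ m → coeff p m ≡ coeff q m
≋⇒coeff {p} {q} (mk≋ p≋q) m = trans (coeff-as-lin p m) (trans (p≋q (indicator m)) (sym (coeff-as-lin q m)))

module Sums {c ℓ} (M : CommutativeMonoid c ℓ) where
  open CommutativeMonoid M using (Carrier; _≈_; _∙_; ε; ∙-cong; setoid; isCommutativeMonoid; isEquivalence)
  open IsEquivalence isEquivalence using () renaming (refl to ≈-refl)

  sumOver : ∀ {I : Set} → List I → (I → Carrier) → Carrier
  sumOver is h = List.foldr (λ i acc → h i ∙ acc) ε is

  sumOver-cong : ∀ {I : Set} (is : List I) {h h′ : I → Carrier} → (∀ i → h i ≈ h′ i) → sumOver is h ≈ sumOver is h′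
  sumOver-cong [] h≈h′ = ≈-refl
  sumOver-cong (i ∷ is) h≈h′ = ∙-cong (h≈h′ i) (sumOver-cong is h≈h′)

  sumOver-reindex : ∀ {I : Set} (π : I → I) {is : List I} → List.map π is ↭ is →
    ∀ h → sumOver is (λ i → h (π i)) ≈ sumOver is h
  sumOver-reindex π {is} π-↭ h = begin
    sumOver is (λ i → h (π i))                  ≡⟨ ListP.foldr-map (λ i acc → h i ∙ acc) π ε is ⟨
    sumOver (List.map π is) h                   ≡⟨ ListP.foldr-map _∙_ h ε (List.map π is) ⟨
    List.foldr _∙_ ε (List.map h (List.map π is))
                                                ≈⟨ foldr-commMonoid setoid isCommutativeMonoid (↭⇒↭ₛ′ isEquivalence (↭-map⁺ h π-↭)) ⟩
    List.foldr _∙_ ε (List.map h is)            ≡⟨ ListP.foldr-map _∙_ h ε is ⟩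
    sumOver is h                                ∎
    where open SetoidReasoning setoid

-- Fractions are compared numerator-wise and denominator-wise.  This finer
-- relation suffices: renaming acts on numerators and denominators separately.
record _≋F_ (x y : Frac) : Set where
  constructor _,_
  field
    num : proj₁ x ≋ proj₁ y
    den : proj₂ x ≋ proj₂ y

≋F-isEquivalence : IsEquivalence _≋F_
≋F-isEquivalence = record
  { refl  = ≋-refl , ≋-refl
  ; sym   = λ (n , d) → ≋-sym n , ≋-sym d
  ; trans = λ (n , d) (n′ , d′) → ≋-trans n n′ , ≋-trans d d′
  }

open IsEquivalence ≋F-isEquivalence public
  using () renaming (refl to ≋F-refl; trans to ≋F-trans)

fMul-cong : ∀ {x x′ y y′} → x ≋F x′ → y ≋F y′ → fMul x y ≋F fMul x′ y′
fMul-cong (n , d) (n′ , d′) = pMul-cong n n′ , pMul-cong d d′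

fAdd-cong : ∀ {x x′ y y′} → x ≋F x′ → y ≋F y′ → fAdd x y ≋F fAdd x′ y′
fAdd-cong (n , d) (n′ , d′) = pAdd-cong (pMul-cong n d′) (pMul-cong n′ d) , pMul-cong d d′

fDiv-cong : ∀ {x x′ y y′} → x ≋F x′ → y ≋F y′ → fDiv x y ≋F fDiv x′ y′
fDiv-cong (n , d) (n′ , d′) = pMul-cong n d′ , pMul-cong d n′

fPow-cong : ∀ {x y} → x ≋F y → ∀ k → fPow x k ≋F fPow y k
fPow-cong x≋y ℕ.zero = ≋F-refl
fPow-cong x≋y (ℕ.suc k) = fMul-cong x≋y (fPow-cong x≋y k)

fMul-isCommutativeMonoid : IsCommutativeMonoid _≋F_ fMul fOne
fMul-isCommutativeMonoid = record
  { isMonoid = record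
    { isSemigroup = record
      { isMagma = record { isEquivalence = ≋F-isEquivalence ; ∙-cong = fMul-cong }
      ; assoc = λ x y z → pMul-assoc (proj₁ x) (proj₁ y) (proj₁ z) , pMul-assoc (proj₂ x) (proj₂ y) (proj₂ z)
      }
    ; identity = identityˡ , λ x → ≋F-trans (comm x fOne) (identityˡ x)
    }
  ; comm = comm
  }
  where
  comm : ∀ x y → fMul x y ≋F fMul y x
  comm x y = pMul-comm (proj₁ x) (proj₁ y) , pMul-comm (proj₂ x) (proj₂ y)
  identityˡ : ∀ x → fMul fOne x ≋F x
  identityˡ x = pMul-identityˡ (proj₁ x) , pMul-identityˡ (proj₂ x)

fracMonoid : CommutativeMonoid 0ℓ 0ℓ
fracMonoid = record { isCommutativeMonoid = fMul-isCommutativeMonoid }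

module ≋F-Reasoning = SetoidReasoning (CommutativeMonoid.setoid fracMonoid)

open Sums fracMonoid using ()
  renaming (sumOver to prodOver; sumOver-cong to prodOver-cong; sumOver-reindex to prodOver-reindex)

reindex : ∀ {A : Set} {m n} → (Fin m → Fin n) → Vec A n → Vec A m
reindex f v = Vec.tabulate (λ k → Vec.lookup v (f k))

vec-ext : ∀ {A : Set} {n} {u v : Vec A n} → (∀ k → Vec.lookup u k ≡ Vec.lookup v k) → u ≡ v
vec-ext {u = u} {v} u≗v = trans (sym (VecP.tabulate∘lookup u)) (trans (VecP.tabulate-cong u≗v) (VecP.tabulate∘lookup v))

reindex-inverse : ∀ {A : Set} {n} (f g : Fin n → Fin n) → (∀ k → g (f k) ≡ k) →
  ∀ (v : Vec A n) → reindex f (reindex g v) ≡ v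
reindex-inverse f g g∘f v = vec-ext λ k → begin
  Vec.lookup (reindex f (reindex g v)) k  ≡⟨ VecP.lookup∘tabulate _ k ⟩
  Vec.lookup (reindex g v) (f k)          ≡⟨ VecP.lookup∘tabulate _ (f k) ⟩
  Vec.lookup v (g (f k))                  ≡⟨ cong (Vec.lookup v) (g∘f k) ⟩
  Vec.lookup v k                          ∎
  where open ≡-Reasoning

reindex-zipWith : ∀ {A : Set} {m n} (_∙_ : A → A → A) (f : Fin m → Fin n) (u v : Vec A n) →
  reindex f (Vec.zipWith _∙_ u v) ≡ Vec.zipWith _∙_ (reindex f u) (reindex f v)
reindex-zipWith _∙_ f u v = vec-ext λ k → begin
  Vec.lookup (reindex f (Vec.zipWith _∙_ u v)) k               ≡⟨ VecP.lookup∘tabulate _ k ⟩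
  Vec.lookup (Vec.zipWith _∙_ u v) (f k)                       ≡⟨ VecP.lookup-zipWith _∙_ (f k) u v ⟩
  Vec.lookup u (f k) ∙ Vec.lookup v (f k)                      ≡⟨ cong₂ _∙_ (VecP.lookup∘tabulate _ k) (VecP.lookup∘tabulate _ k) ⟨
  Vec.lookup (reindex f u) k ∙ Vec.lookup (reindex f v) k      ≡⟨ VecP.lookup-zipWith _∙_ k (reindex f u) (reindex f v) ⟨
  Vec.lookup (Vec.zipWith _∙_ (reindex f u) (reindex f v)) k   ∎
  where open ≡-Reasoning

reindex-replicate : ∀ {A : Set} {m n} (f : Fin m → Fin n) (a : A) → reindex f (Vec.replicate n a) ≡ Vec.replicate m a
reindex-replicate f a = vec-ext λ k →
  trans (VecP.lookup∘tabulate _ k) (trans (VecP.lookup-replicate (f k) a) (sym (VecP.lookup-replicate k a)))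

reindex-map : ∀ {A B : Set} {m n} (f : A → B) (g : Fin m → Fin n) (v : Vec A n) →
  reindex g (Vec.map f v) ≡ Vec.map f (reindex g v)
reindex-map f g v =
  trans (VecP.tabulate-cong (λ k → VecP.lookup-map (g k) f v)) (VecP.tabulate-∘ f (λ k → Vec.lookup v (g k)))

degMonoid : CommutativeMonoid 0ℓ 0ℓ
degMonoid = record
  { Carrier = Deg ; _≈_ = _≡_ ; _∙_ = dAdd ; ε = Vec.replicate 3 0ℤ
  ; isCommutativeMonoid = record
    { isMonoid = record
      { isSemigroup = record
        { isMagma = record { isEquivalence = ≡-isEquivalence ; ∙-cong = cong₂ dAdd }
        ; assoc = VecP.zipWith-assoc ℤP.+-assoc
        }
      ; identity = VecP.zipWith-identityˡ ℤP.+-identityˡ , VecP.zipWith-identityʳ ℤP.+-identityʳ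
      }
    ; comm = VecP.zipWith-comm ℤP.+-comm
    }
  }

open Sums degMonoid using ()
  renaming (sumOver to degSum; sumOver-cong to degSum-cong; sumOver-reindex to degSum-reindex)

degTerm : Mono → Fin 6 → Deg
degTerm m i = Vec.map (λ d → ℤ.+ Vec.lookup m i * d) (degVar i)

reindex-degSum : ∀ (f : Fin 3 → Fin 3) (is : List (Fin 6)) h →
  reindex f (degSum is h) ≡ degSum is (λ i → reindex f (h i))
reindex-degSum f [] h = reindex-replicate f 0ℤ
reindex-degSum f (i ∷ is) h =
  trans (reindex-zipWith _+_ f (h i) (degSum is h)) (cong (dAdd (reindex f (h i))) (reindex-degSum f is h))

inverse-⇔ : ∀ {A B : Set} (f : A → B) (g : B → A) → (∀ x → g (f x) ≡ x) → (∀ y → f (g y) ≡ y) →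
  ∀ x y → (f x ≡ y) ⇔ (x ≡ g y)
inverse-⇔ f g g∘f f∘g x y = mk⇔ (λ fx≡y → trans (sym (g∘f x)) (cong g fx≡y)) (λ x≡gy → trans (cong f x≡gy) (f∘g y))

does-≟-invertible : ∀ {n} (f g : Fin n → Fin n) → (∀ x → g (f x) ≡ x) →
  ∀ x y → does (f x Fin.≟ f y) ≡ does (x Fin.≟ y)
does-≟-invertible f g g∘f x y =
  does-⇔ (mk⇔ (λ fx≡fy → trans (sym (g∘f x)) (trans (cong g fx≡fy) (g∘f y))) (cong f)) (f x Fin.≟ f y) (x Fin.≟ y)

module Renaming (π π⁻¹ : Fin 6 → Fin 6)
  (π⁻¹∘π : ∀ i → π⁻¹ (π i) ≡ i) (π∘π⁻¹ : ∀ i → π (π⁻¹ i) ≡ i) where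

  renameMono : Mono → Mono
  renameMono = reindex π⁻¹

  rename : Poly → Poly
  rename = List.map (λ (c , u) → (c , renameMono u))

  lin-rename : ∀ F p → lin F (rename p) ≡ lin (λ u → F (renameMono u)) p
  lin-rename F [] = refl
  lin-rename F ((c , u) ∷ p) = cong ((c * F (renameMono u)) +_) (lin-rename F p)

  rename-pMul : ∀ p q → rename (pMul p q) ≋ pMul (rename p) (rename q)
  rename-pMul p q = mk≋ λ F → begin
    lin F (rename (pMul p q))                                              ≡⟨ lin-rename F (pMul p q) ⟩
    lin (λ w → F (renameMono w)) (pMul p q)                                ≡⟨ lin-pMul _ p q ⟩
    lin (λ u → lin (λ v → F (renameMono (u ⊕ v))) q) p
      ≡⟨ lin-cong (λ u → lin-cong (λ v → cong F (reindex-zipWith ℕ._+_ π⁻¹ u v)) q) p ⟩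
    lin (λ u → lin (λ v → F (renameMono u ⊕ renameMono v)) q) p            ≡⟨ lin-cong (λ u → lin-rename (λ v → F (renameMono u ⊕ v)) q) p ⟨
    lin (λ u → lin (λ v → F (renameMono u ⊕ v)) (rename q)) p              ≡⟨ lin-rename _ p ⟨
    lin (λ u → lin (λ v → F (u ⊕ v)) (rename q)) (rename p)                ≡⟨ lin-pMul F (rename p) (rename q) ⟨
    lin F (pMul (rename p) (rename q))                                     ∎
    where open ≡-Reasoning

  rename-pAdd : ∀ p q → rename (pAdd p q) ≡ pAdd (rename p) (rename q)
  rename-pAdd = ListP.map-++ _

  rename-pOne : rename pOne ≡ pOne
  rename-pOne = cong (λ u → (1ℤ , u) ∷ []) (reindex-replicate π⁻¹ 0)

  rename-pVar : ∀ i → rename (pVar i) ≡ pVar (π i)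
  rename-pVar i = cong (λ u → (1ℤ , u) ∷ []) (vec-ext λ k → begin
    Vec.lookup (renameMono (unit i)) k    ≡⟨ VecP.lookup∘tabulate (λ k → Vec.lookup (unit i) (π⁻¹ k)) k ⟩
    Vec.lookup (unit i) (π⁻¹ k)           ≡⟨ VecP.lookup∘tabulate (λ j → bit (does (i Fin.≟ j))) (π⁻¹ k) ⟩
    bit (does (i Fin.≟ π⁻¹ k))
      ≡⟨ cong bit (does-⇔ (inverse-⇔ π π⁻¹ π⁻¹∘π π∘π⁻¹ i k) (π i Fin.≟ k) (i Fin.≟ π⁻¹ k)) ⟨
    bit (does (π i Fin.≟ k))              ≡⟨ VecP.lookup∘tabulate (λ j → bit (does (π i Fin.≟ j))) k ⟨
    Vec.lookup (unit (π i)) k             ∎)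
    where
    open ≡-Reasoning
    bit : Bool → ℕ
    bit b = if b then 1 else 0
    unit : Fin 6 → Mono
    unit i = Vec.tabulate (λ j → bit (does (i Fin.≟ j)))

  coeff-rename : ∀ p m → coeff (rename p) m ≡ coeff p (reindex π m)
  coeff-rename [] m = refl
  coeff-rename ((c , u) ∷ p) m =
    cong₂ (λ b x → if b then c + x else x)
      (does-⇔ (inverse-⇔ renameMono (reindex π) (reindex-inverse π π⁻¹ π⁻¹∘π) (reindex-inverse π⁻¹ π π∘π⁻¹) u m)
              (VecP.≡-dec ℕ._≟_ (renameMono u) m) (VecP.≡-dec ℕ._≟_ u (reindex π m)))
      (coeff-rename p m)

  renameF : Frac → Frac
  renameF (n , d) = (rename n , rename d)

  renameF-fMul : ∀ x y → renameF (fMul x y) ≋F fMul (renameF x) (renameF y)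
  renameF-fMul (a , b) (c , d) = rename-pMul a c , rename-pMul b d

  renameF-fAdd : ∀ x y → renameF (fAdd x y) ≋F fAdd (renameF x) (renameF y)
  renameF-fAdd (a , b) (c , d) =
    ≋-trans (≋-reflexive (rename-pAdd (pMul a d) (pMul c b))) (pAdd-cong (rename-pMul a d) (rename-pMul c b)) ,
    rename-pMul b d

  renameF-fDiv : ∀ x y → renameF (fDiv x y) ≋F fDiv (renameF x) (renameF y)
  renameF-fDiv (a , b) (c , d) = rename-pMul a d , rename-pMul b c

  renameF-fOne : renameF fOne ≋F fOne
  renameF-fOne = ≋-reflexive rename-pOne , ≋-reflexive rename-pOne

  renameF-fPow : ∀ x k → renameF (fPow x k) ≋F fPow (renameF x) k
  renameF-fPow x ℕ.zero = renameF-fOne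
  renameF-fPow x (ℕ.suc k) = ≋F-trans (renameF-fMul x (fPow x k)) (fMul-cong (≋F-refl {renameF x}) (renameF-fPow x k))

  renameF-prodOver : ∀ (is : List (Fin 6)) h → renameF (prodOver is h) ≋F prodOver is (λ i → renameF (h i))
  renameF-prodOver [] h = renameF-fOne
  renameF-prodOver (i ∷ is) h =
    ≋F-trans (renameF-fMul (h i) (prodOver is h)) (fMul-cong (≋F-refl {renameF (h i)}) (renameF-prodOver is h))

coef : Fin 3 → Fin 6
coef k = suc (suc (suc k))

data Position : Fin 6 → Set where
  cluster     : ∀ k → Position (row k)
  coefficient : ∀ k → Position (coef k)

position : ∀ i → Position i
position zero = cluster zero
position (suc zero) = cluster (suc zero)
position (suc (suc zero)) = cluster (suc (suc zero))
position (suc (suc (suc k))) = coefficient k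

ext-row : ∀ s k → ext s (row k) ≡ clu s k
ext-row s zero = refl
ext-row s (suc zero) = refl
ext-row s (suc (suc zero)) = refl

ext-coef : ∀ s k → ext s (coef k) ≡ (pVar (coef k) , pOne)
ext-coef s zero = refl
ext-coef s (suc zero) = refl
ext-coef s (suc (suc zero)) = refl

lift : (Fin 3 → Fin 3) → Fin 6 → Fin 6
lift σ zero = row (σ zero)
lift σ (suc zero) = row (σ (suc zero))
lift σ (suc (suc zero)) = row (σ (suc (suc zero)))
lift σ (suc (suc (suc k))) = coef (σ k)

lift-row : ∀ σ k → lift σ (row k) ≡ row (σ k)
lift-row σ zero = refl
lift-row σ (suc zero) = refl
lift-row σ (suc (suc zero)) = refl

lift-inverse : ∀ σ σ′ → (∀ k → σ′ (σ k) ≡ k) → ∀ i → lift σ′ (lift σ i) ≡ i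
lift-inverse σ σ′ σ′∘σ i with position i
... | cluster k = trans (cong (lift σ′) (lift-row σ k)) (trans (lift-row σ′ (σ k)) (cong row (σ′∘σ k)))
... | coefficient k = cong coef (σ′∘σ k)

lift-↭ : ∀ σ → List.map σ (List.allFin 3) ↭ List.allFin 3 → List.map (lift σ) (List.allFin 6) ↭ List.allFin 6
lift-↭ σ σ-perm = ↭-++⁺ (↭-map⁺ row σ-perm) (↭-map⁺ coef σ-perm)

exchangeMonomial : (ℤ → ℤ) → Fin 3 → Seed → Frac
exchangeMonomial E k s = fProd (λ i → fPow (ext s i) [ E (mat s i k) ]₊)

clu-mutate : ∀ k s j → clu (mutate k s) j ≡
  (if does (j Fin.≟ k) then fDiv (fAdd (exchangeMonomial (λ b → b) k s) (exchangeMonomial -_ k s)) (clu s k) else clu s j)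
clu-mutate k s j = refl

-- A relabelling σ of the directions which fixes B̃₀ and respects the
-- ℤ³-grading is a symmetry of the whole exchange tree: mutating along a
-- word relabelled by σ produces the renamed seed, so g-vectors are permuted.
module Symmetry (σ σ⁻¹ : Fin 3 → Fin 3)
  (σ⁻¹∘σ : ∀ k → σ⁻¹ (σ k) ≡ k) (σ∘σ⁻¹ : ∀ k → σ (σ⁻¹ k) ≡ k)
  (σ-↭ : List.map σ (List.allFin 3) ↭ List.allFin 3)
  (B0-invariant : ∀ i j → B0 (lift σ i) (σ j) ≡ B0 i j)
  (degVar-equivariant : ∀ i → degVar (lift σ i) ≡ reindex σ⁻¹ (degVar i))
  where

  π : Fin 6 → Fin 6
  π = lift σ

  open Renaming π (lift σ⁻¹) (lift-inverse σ σ⁻¹ σ⁻¹∘σ) (lift-inverse σ⁻¹ σ σ∘σ⁻¹)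

  permDeg : Deg → Deg
  permDeg = reindex σ⁻¹

  grading-equivariant : ∀ m → monoDeg (renameMono m) ≡ permDeg (monoDeg m)
  grading-equivariant m = begin
    degSum (List.allFin 6) (degTerm (renameMono m))               ≡⟨ degSum-reindex π (lift-↭ σ σ-↭) (degTerm (renameMono m)) ⟨
    degSum (List.allFin 6) (λ i → degTerm (renameMono m) (π i))   ≡⟨ degSum-cong (List.allFin 6) term-equivariant ⟩
    degSum (List.allFin 6) (λ i → permDeg (degTerm m i))          ≡⟨ reindex-degSum σ⁻¹ (List.allFin 6) (degTerm m) ⟨
    permDeg (monoDeg m)                                           ∎
    where
    open ≡-Reasoning
    exponent-equivariant : ∀ i → Vec.lookup (renameMono m) (π i) ≡ Vec.lookup m i
    exponent-equivariant i =
      trans (VecP.lookup∘tabulate (λ k → Vec.lookup m (lift σ⁻¹ k)) (π i)) (cong (Vec.lookup m) (lift-inverse σ σ⁻¹ σ⁻¹∘σ i))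
    term-equivariant : ∀ i → degTerm (renameMono m) (π i) ≡ permDeg (degTerm m i)
    term-equivariant i = begin
      Vec.map (λ d → ℤ.+ Vec.lookup (renameMono m) (π i) * d) (degVar (π i))
        ≡⟨ cong₂ (λ e v → Vec.map (λ d → ℤ.+ e * d) v) (exponent-equivariant i) (degVar-equivariant i) ⟩
      Vec.map (λ d → ℤ.+ Vec.lookup m i * d) (permDeg (degVar i))              ≡⟨ reindex-map (λ d → ℤ.+ Vec.lookup m i * d) σ⁻¹ (degVar i) ⟨
      permDeg (degTerm m i)                                                  ∎

  homogeneous-rename : ∀ f a → Homogeneous f a → Homogeneous (rename f) (permDeg a)
  homogeneous-rename f a f-hom m coeff≢0 = begin
    monoDeg m                                  ≡⟨ cong monoDeg (reindex-inverse (lift σ⁻¹) π (lift-inverse σ⁻¹ σ σ∘σ⁻¹) m) ⟨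
    monoDeg (renameMono (reindex π m))         ≡⟨ grading-equivariant (reindex π m) ⟩
    permDeg (monoDeg (reindex π m))            ≡⟨ cong permDeg (f-hom (reindex π m) (λ c≡0 → coeff≢0 (trans (coeff-rename f m) c≡0))) ⟩
    permDeg a                                  ∎
    where open ≡-Reasoning

  hasDeg-rename : ∀ x x′ v → HasDeg x v → renameF x ≋F x′ → HasDeg x′ (permDeg v)
  hasDeg-rename (n , d) (n′ , d′) v (f , g , a , b , f-hom , g-hom , (m , g≢0) , cross , v≡a-b) (n≋ , d≋) =
    rename f , rename g , permDeg a , permDeg b ,
    homogeneous-rename f a f-hom , homogeneous-rename g b g-hom ,
    (renameMono m , g′≢0) , cross′ ,
    trans (cong permDeg v≡a-b) (reindex-zipWith _-_ σ⁻¹ a b)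
    where
    g′≢0 : coeff (rename g) (renameMono m) ≢ 0ℤ
    g′≢0 c≡0 = g≢0 (trans (sym (trans (coeff-rename g (renameMono m))
                                      (cong (coeff g) (reindex-inverse π (lift σ⁻¹) (lift-inverse σ σ⁻¹ σ⁻¹∘σ) m)))) c≡0)
    cross′ : ∀ m → coeff (pMul n′ (rename g)) m ≡ coeff (pMul (rename f) d′) m
    cross′ m = begin
      coeff (pMul n′ (rename g)) m          ≡⟨ ≋⇒coeff (≋-trans (rename-pMul n g) (pMul-cong n≋ ≋-refl)) m ⟨
      coeff (rename (pMul n g)) m           ≡⟨ coeff-rename (pMul n g) m ⟩
      coeff (pMul n g) (reindex π m)        ≡⟨ cross (reindex π m) ⟩
      coeff (pMul f d) (reindex π m)        ≡⟨ coeff-rename (pMul f d) m ⟨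
      coeff (rename (pMul f d)) m           ≡⟨ ≋⇒coeff (≋-trans (rename-pMul f d) (pMul-cong (≋-refl {rename f}) d≋)) m ⟩
      coeff (pMul (rename f) d′) m          ∎
      where open ≡-Reasoning

  record Equivariant (s s′ : Seed) : Set where
    field
      mat-≡ : ∀ i j → mat s′ (π i) (σ j) ≡ mat s i j
      clu-≋ : ∀ k → renameF (clu s k) ≋F clu s′ (σ k)
  open Equivariant

  ext-equivariant : ∀ {s s′} → Equivariant s s′ → ∀ i → renameF (ext s i) ≋F ext s′ (π i)
  ext-equivariant {s} {s′} R i with position i
  ... | cluster k rewrite ext-row s k | lift-row σ k | ext-row s′ (σ k) = clu-≋ R k
  ... | coefficient k rewrite ext-coef s k | ext-coef s′ (σ k) =
    ≋-reflexive (rename-pVar (coef k)) , ≋-reflexive rename-pOne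

  -- The exchange monomials correspond, after reordering the factors by π.
  exchangeMonomial-equivariant : ∀ E k {s s′} → Equivariant s s′ →
    renameF (exchangeMonomial E k s) ≋F exchangeMonomial E (σ k) s′
  exchangeMonomial-equivariant E k {s} {s′} R = begin
    renameF (fProd (λ i → fPow (ext s i) (exponent s i k)))
      ≈⟨ renameF-prodOver (List.allFin 6) (λ i → fPow (ext s i) (exponent s i k)) ⟩
    fProd (λ i → renameF (fPow (ext s i) (exponent s i k)))        ≈⟨ prodOver-cong (List.allFin 6) factor ⟩
    fProd (λ i → fPow (ext s′ (π i)) (exponent s′ (π i) (σ k)))
      ≈⟨ prodOver-reindex π (lift-↭ σ σ-↭) (λ i → fPow (ext s′ i) (exponent s′ i (σ k))) ⟩
    fProd (λ i → fPow (ext s′ i) (exponent s′ i (σ k)))             ∎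
    where
    open ≋F-Reasoning
    exponent : Seed → Fin 6 → Fin 3 → ℕ
    exponent s i k = [ E (mat s i k) ]₊
    factor : ∀ i → renameF (fPow (ext s i) (exponent s i k)) ≋F fPow (ext s′ (π i)) (exponent s′ (π i) (σ k))
    factor i rewrite mat-≡ R i k = ≋F-trans (renameF-fPow (ext s i) _) (fPow-cong (ext-equivariant R i) _)

  mutate-equivariant : ∀ k {s s′} → Equivariant s s′ → Equivariant (mutate k s) (mutate (σ k) s′)
  mutate-equivariant k {s} {s′} R = record { mat-≡ = mat-part ; clu-≋ = clu-part }
    where
    row-does : ∀ i → does (π i Fin.≟ row (σ k)) ≡ does (i Fin.≟ row k)
    row-does i = trans (cong (λ r → does (π i Fin.≟ r)) (sym (lift-row σ k)))
                       (does-≟-invertible π (lift σ⁻¹) (lift-inverse σ σ⁻¹ σ⁻¹∘σ) i (row k))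
    mat-part : ∀ i j → mutMat (σ k) (mat s′) (π i) (σ j) ≡ mutMat k (mat s) i j
    mat-part i j rewrite row-does i | does-≟-invertible σ σ⁻¹ σ⁻¹∘σ j k | sym (lift-row σ k)
                       | mat-≡ R i j | mat-≡ R i k | mat-≡ R (row k) j = refl
    clu-part : ∀ j → renameF (clu (mutate k s) j) ≋F clu (mutate (σ k) s′) (σ j)
    clu-part j rewrite clu-mutate k s j | clu-mutate (σ k) s′ (σ j) | does-≟-invertible σ σ⁻¹ σ⁻¹∘σ j k
      with does (j Fin.≟ k)
    ... | false = clu-≋ R j
    ... | true = begin
      renameF (fDiv (fAdd P Q) (clu s k))                        ≈⟨ renameF-fDiv (fAdd P Q) (clu s k) ⟩
      fDiv (renameF (fAdd P Q)) (renameF (clu s k))              ≈⟨ fDiv-cong (renameF-fAdd P Q) (clu-≋ R k) ⟩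
      fDiv (fAdd (renameF P) (renameF Q)) (clu s′ (σ k))         ≈⟨ fDiv-cong (fAdd-cong (exchangeMonomial-equivariant (λ b → b) k R)
                                                                                         (exchangeMonomial-equivariant -_ k R)) ≋F-refl ⟩
      fDiv (fAdd P′ Q′) (clu s′ (σ k))                           ∎
      where
      open ≋F-Reasoning
      P Q P′ Q′ : Frac
      P = exchangeMonomial (λ b → b) k s
      Q = exchangeMonomial -_ k s
      P′ = exchangeMonomial (λ b → b) (σ k) s′
      Q′ = exchangeMonomial -_ (σ k) s′

  initial-equivariant : Equivariant initialSeed initialSeed
  initial-equivariant = record
    { mat-≡ = B0-invariant
    ; clu-≋ = λ k → ≋-reflexive (trans (rename-pVar (row k)) (cong pVar (lift-row σ k))) , ≋-reflexive rename-pOne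
    }

  seedOf-equivariant : (σL : Lbl → Lbl) → (∀ a → idx (σL a) ≡ σ (idx a)) →
    ∀ w → Equivariant (seedOf w) (seedOf (List.map σL w))
  seedOf-equivariant σL idx-σL w = go w initial-equivariant
    where
    go : ∀ w {s s′} → Equivariant s s′ →
      Equivariant (List.foldl (λ s a → mutate (idx a) s) s w) (List.foldl (λ s a → mutate (idx a) s) s′ (List.map σL w))
    go [] R = R
    go (a ∷ w) {s} {s′} R rewrite idx-σL a = go w {mutate (idx a) s} (mutate-equivariant (idx a) R)

  gMatrix-equivariant : (σL : Lbl → Lbl) → (∀ a → idx (σL a) ≡ σ (idx a)) →
    ∀ w G → IsGMatrix w G → IsGMatrix (List.map σL w) (λ i j → G (σ⁻¹ i) (σ⁻¹ j))
  gMatrix-equivariant σL idx-σL w G G-w j =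
    subst₂ HasDeg (cong (clu (seedOf (List.map σL w))) (σ∘σ⁻¹ j))
      (VecP.tabulate-cong (λ i → VecP.lookup∘tabulate (λ i → G i (σ⁻¹ j)) (σ⁻¹ i)))
      (hasDeg-rename _ _ _ (G-w (σ⁻¹ j)) (clu-≋ (seedOf-equivariant σL idx-σL w) (σ⁻¹ j)))

-- φ relabels the directions by the 3-cycle ρ : 0 ↦ -1 ↦ ∞ ↦ 0, whose inverse is τ.
ρ : Fin 3 → Fin 3
ρ zero = suc zero
ρ (suc zero) = suc (suc zero)
ρ (suc (suc zero)) = zero

τ∘ρ : ∀ k → τ (ρ k) ≡ k
τ∘ρ zero = refl
τ∘ρ (suc zero) = refl
τ∘ρ (suc (suc zero)) = refl

ρ∘τ : ∀ k → ρ (τ k) ≡ k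
ρ∘τ zero = refl
ρ∘τ (suc zero) = refl
ρ∘τ (suc (suc zero)) = refl

ρ-↭ : List.map ρ (List.allFin 3) ↭ List.allFin 3
ρ-↭ = ↭-shift zero (suc zero ∷ suc (suc zero) ∷ []) []

B0-ρ-invariant : ∀ i j → B0 (lift ρ i) (ρ j) ≡ B0 i j
B0-ρ-invariant = from-yes (FinP.all? λ i → FinP.all? λ j → B0 (lift ρ i) (ρ j) ℤ.≟ B0 i j)

degVar-ρ-equivariant : ∀ i → degVar (lift ρ i) ≡ reindex τ (degVar i)
degVar-ρ-equivariant = from-yes (FinP.all? λ i → VecP.≡-dec ℤ._≟_ (degVar (lift ρ i)) (reindex τ (degVar i)))

idx-σφ : ∀ a → idx (σφ a) ≡ ρ (idx a)
idx-σφ L0 = refl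
idx-σφ L-1 = refl
idx-σφ L∞ = refl

open Symmetry ρ τ τ∘ρ ρ∘τ ρ-↭ B0-ρ-invariant degVar-ρ-equivariant using (gMatrix-equivariant)

φ-gMatrix : ∀ T G → IsGMatrix T G → IsGMatrix (φ T) (G ^φ)
φ-gMatrix = gMatrix-equivariant σφ idx-σφ

ψ≡φ∘φ : ∀ T → ψ T ≡ φ (φ T)
ψ≡φ∘φ T = trans (ListP.map-cong σψ≡σφ² T) (ListP.map-∘ T)
  where
  σψ≡σφ² : ∀ a → σψ a ≡ σφ (σφ a)
  σψ≡σφ² L0 = refl
  σψ≡σφ² L-1 = refl
  σψ≡σφ² L∞ = refl

τ∘τ : ∀ k → τ (τ k) ≡ τ⁻¹ k
τ∘τ zero = refl
τ∘τ (suc zero) = refl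
τ∘τ (suc (suc zero)) = refl

IsGMatrix-cong : ∀ {T G G′} → (∀ i j → G i j ≡ G′ i j) → IsGMatrix T G → IsGMatrix T G′
IsGMatrix-cong {T} G≡G′ G-T j = subst (HasDeg (clu (seedOf T) j)) (VecP.tabulate-cong (λ i → G≡G′ i j)) (G-T j)

mainTheorem8 : (T : List Lbl) → InT3m1 T → (G : Mat3) → IsGMatrix T G →
    IsGMatrix (φ T) (G ^φ) × IsGMatrix (ψ T) (G ^ψ)
mainTheorem8 T _ G G-T = φ-part , ψ-part
  where
  φ-part : IsGMatrix (φ T) (G ^φ)
  φ-part = φ-gMatrix T G G-T
  ψ-part : IsGMatrix (ψ T) (G ^ψ)
  ψ-part = subst (λ w → IsGMatrix w (G ^ψ)) (sym (ψ≡φ∘φ T))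
    (IsGMatrix-cong {φ (φ T)} (λ i j → cong₂ G (τ∘τ i) (τ∘τ j)) (φ-gMatrix (φ T) (G ^φ) φ-part))
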